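{- Let $X$ be a set of size $n$, $A\subset[n]$ with $|A|=m$. For $x\in X^n$ let $\pi=\ker(x|_A)$. Then \[P_A1_S(x)=(-1)^{\operatorname{rank}(\pi)}\frac{n!}{n^n}\,U\prod_{p\in\pi}(|p|z-1).\]
   Context: $S\subset X^n$ is the set of bijections $[n]\to X$. Functions on $X^n$ carry the inner product $\mathbf{E}_{x\in X^n}f\bar g$; for $B\subset[n]$, $Q_B$ is the orthogonal projection onto functions depending only on $(x_i:i\in B)$ and $P_A=\sum_{B\subset A}(-1)^{|A\setminus B|}Q_B$. For $x\in X^n$, $\ker(x|_A)$ is the partition of $A$ into nonempty level sets $\{a\in A:x_a=t\}$, $t\in X$. For a partition $\pi$ of $A$, $\operatorname{rank}(\pi)=|A|-|\pi|$. $U:\mathbf{C}[z]\to\mathbf{C}$ is the linear map with $U(z^k)=n^k/(n)_k$ for $k\le n$ and $U(z^k)=0$ for $k>n$, where $(n)_k=n(n-1)\cdots(n-k+1)$. -}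

module Defs where

open import Data.Bool using (Bool; true; false; if_then_else_; _∧_)
open import Data.Nat as ℕ using (ℕ; zero; suc; _∸_; _≤ᵇ_)
open import Data.Nat.Combinatorics using () renaming (_P_ to _fall_)
open import Data.Integer using (+_)
open import Data.Rational using (ℚ; 0ℚ; 1ℚ; _+_; _*_; -_; _/_)
open import Data.Fin using (Fin; zero; suc; _≟_)
open import Data.Fin.Subset using (Subset; _─_; ∣_∣; outside; inside)
open import Data.Fin.Subset.Properties using (_⊆?_)
open import Data.List using (List; []; _∷_; [_]; map; concatMap; filter; length; foldr)
open import Data.Bool.ListAction using (all; any)
open import Data.List using () renaming (allFin to finList)
open import Data.Vec using (Vec; lookup; []; _∷_)
open import Relation.Nullary using (does)
open import Relation.Nullary.Decidable using (T?; ¬?)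

-- natural-number fraction a / b as a rational (b = 0 never occurs below; we set it to 0)
_//_ : ℕ → ℕ → ℚ
a // zero = 0ℚ
a // suc b = (+ a) / suc b

neg1^ : ℕ → ℚ
neg1^ zero = 1ℚ
neg1^ (suc k) = - neg1^ k

sumℚ : List ℚ → ℚ
sumℚ = foldr _+_ 0ℚ

avg : List ℚ → ℚ
avg l = sumℚ l * (1 // length l)

allFns : (n k : ℕ) → List (Fin k → Fin n)
allFns n zero = [ (λ ()) ]
allFns n (suc k) =
  concatMap (λ t → map (λ f → λ { zero → t ; (suc i) → f i }) (allFns n k)) (finList n)

allSubsets : (k : ℕ) → List (Subset k)
allSubsets zero = [ [] ]
allSubsets (suc k) =
  map (outside ∷_) (allSubsets k) Data.List.++ map (inside ∷_) (allSubsets k)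

eqᵇ : ∀ {n} → Fin n → Fin n → Bool
eqᵇ a b = does (a ≟ b)

-- S : bijections [n] → X, X = Fin n (injective and surjective)
isBij : ∀ {n} → (Fin n → Fin n) → Bool
isBij {n} y =
  all (λ i → all (λ j → if eqᵇ (y i) (y j) then eqᵇ i j else true) (finList n)) (finList n)
  ∧ all (λ t → any (λ i → eqᵇ (y i) t) (finList n)) (finList n)

1S : ∀ {n} → (Fin n → Fin n) → ℚ
1S y = if isBij y then 1ℚ else 0ℚ

agreeOn : ∀ {n} → Subset n → (Fin n → Fin n) → (Fin n → Fin n) → Bool
agreeOn {n} B x y = all (λ i → if lookup B i then eqᵇ (x i) (y i) else true) (finList n)

-- Q_B f : orthogonal projection (w.r.t. uniform measure on X^n) onto functions of (x_i : i ∈ B),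
-- i.e. the conditional expectation  Q_B f (x) = E[ f(y) | y_i = x_i for i ∈ B ]
Q : ∀ {n} → Subset n → ((Fin n → Fin n) → ℚ) → (Fin n → Fin n) → ℚ
Q {n} B f x = avg (map f (filter (λ y → T? (agreeOn B x y)) (allFns n n)))

P : ∀ {n} → Subset n → ((Fin n → Fin n) → ℚ) → (Fin n → Fin n) → ℚ
P {n} A f x =
  sumℚ (map (λ B → neg1^ ∣ A ─ B ∣ * Q B f x) (filter (λ B → B ⊆? A) (allSubsets n)))

ker : ∀ {n} → (Fin n → Fin n) → Subset n → List (List (Fin n))
ker {n} x A =
  filter (λ p → ¬? (length p ℕ.≟ 0))
    (map (λ t → filter (λ a → T? (lookup A a ∧ eqᵇ (x a) t)) (finList n)) (finList n))

-- polynomials in z as coefficient lists (constant term first)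
Poly : Set
Poly = List ℚ

addP : Poly → Poly → Poly
addP [] q = q
addP (a ∷ p) [] = a ∷ p
addP (a ∷ p) (b ∷ q) = (a + b) ∷ addP p q

scaleP : ℚ → Poly → Poly
scaleP c = map (c *_)

mulP : Poly → Poly → Poly
mulP [] q = []
mulP (a ∷ p) q = addP (scaleP a q) (0ℚ ∷ mulP p q)

prodP : List Poly → Poly
prodP = foldr mulP (1ℚ ∷ [])

linP : ℕ → Poly
linP c = (- 1ℚ) ∷ ((+ c) / 1) ∷ []

Uz : ℕ → ℕ → ℚ
Uz n k = if k ≤ᵇ n then (n ℕ.^ k) // (n fall k) else 0ℚ

Ucoeffs : ℕ → ℕ → Poly → ℚ
Ucoeffs n k [] = 0ℚ
Ucoeffs n k (c ∷ p) = c * Uz n k + Ucoeffs n (suc k) p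

U : ℕ → Poly → ℚ
U n = Ucoeffs n 0

rank : ∀ {n} → Subset n → List (List (Fin n)) → ℕ
rank A π = ∣ A ∣ ∸ length π

{-# OPTIONS --safe #-}
-- Given y|_B = x|_B, the n^(n-|B|) extensions contain (n-|B|)! bijections if x|_B
-- is injective and none otherwise, so Q_B 1_S(x) = (n!/n^n) U(z^|B|) [x|_B injective].  Hence
-- P_A 1_S(x) = (n!/n^n) U(Σ (-1)^|A∖B| z^|B|), summed over the B ⊆ A on which x is injective, and
-- this polynomial factors over the blocks p of ker(x|_A): B meets p in at most one point, which
-- contributes (-1)^|p| + |p| (-1)^(|p|-1) z = (-1)^(|p|-1) (|p| z - 1).
--
-- Polynomials are handled through the linear functionals z^j ↦ c j, under which multiplication by
-- z becomes the shift of c; the sum over B is computed one point of A at a time.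
module Submission where

open import Defs
open import Data.Nat using (ℕ; _!; _^_)
open import Data.Fin using (Fin)
open import Data.Fin.Subset using (Subset; ∣_∣)
open import Data.List using (map; length)
open import Data.Rational using (_*_)
open import Relation.Binary.PropositionalEquality using (_≡_)

open import Algebra.Bundles using (CommutativeMonoid)
import Algebra.Properties.CommutativeSemigroup as CommutativeSemigroupProperties
open import Data.Bool using (Bool; true; false; if_then_else_; _∧_; _∨_; not; T)
import Data.Bool.Properties as ℬ
open import Data.Bool.ListAction using (and)
open import Data.Fin using (zero; suc; _≟_; punchOut)
import Data.Fin.Properties as Fin
open import Data.Fin.Subset using (⊤; outside; inside; _─_)
open import Data.Fin.Subset.Properties using (∣p∣≤n; _⊆?_)
import Data.Integer as ℤ
import Data.Integer.Properties as ℤ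
open import Data.List using (List; []; _∷_; _++_; tabulate; filter; concatMap; allFin)
import Data.List.Properties as List
open import Data.List.Relation.Unary.All.Properties using (all⁺; all⁻)
import Data.List.Relation.Unary.All.Properties as All
open import Data.List.Relation.Unary.Any.Properties using (any⁺)
import Data.List.Relation.Unary.Any.Properties as Any
open import Data.Maybe using (nothing)
open import Data.Nat as ℕ using (zero; suc; NonZero; _∸_; _≤_)
import Data.Nat.Properties as ℕ
import Data.Nat.ListAction as ListAction
open import Data.Nat.Combinatorics.Base using (_P′_)
open import Data.Nat.Combinatorics.Specification using (nP′k≡n[n∸1P′k∸1]; nP′k≡n!/[n∸k]!; nP′n≡n!)
open import Data.Nat.DivMod using (m/n*n≡m)
open import Data.Nat.Divisibility using (m≤n⇒m!∣n!)
open import Data.Nat.Tactic.RingSolver using () renaming (solve-∀ to ℕ-solve-∀)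
open import Data.Product using (_×_; _,_; proj₁; proj₂; ∃)
open import Data.Rational using (ℚ; 0ℚ; 1ℚ; _+_; -_; fromℚᵘ)
import Data.Rational.Properties as ℚ
import Data.Rational.Unnormalised as ℚᵘ
import Data.Rational.Unnormalised.Properties as ℚᵘ
open import Data.Vec using ([]; _∷_; lookup)
open import Function using (_∘_; id)
open import Function.Bundles using (Equivalence; _⇔_; mk⇔)
open import Function.Definitions using (Injective)
open import Relation.Binary.PropositionalEquality using (_≢_; refl; sym; trans; cong; cong₂; subst; module ≡-Reasoning)
open import Relation.Nullary using (Dec; does; yes; no; contradiction)
open import Relation.Nullary.Decidable using (T?; ¬?; dec-true; dec-false)
import Relation.Nullary.Reflects as Reflects
open import Tactic.RingSolver using (solve-∀)
open import Tactic.RingSolver.Core.AlmostCommutativeRing using (AlmostCommutativeRing; fromCommutativeRing)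
open import Algebra.Properties.CommutativeMonoid.Sum ℕ.+-0-commutativeMonoid
  using (sum; sum-cong-≗; ∑-distrib-+; sum-replicate-zero)
open import Algebra.Properties.Semiring.Sum ℕ.+-*-semiring using (*-distribʳ-sum)
open import Algebra.Properties.Ring ℚ.+-*-ring using (-1*x≈-x)

open ≡-Reasoning

module ∨-CS = CommutativeSemigroupProperties (CommutativeMonoid.commutativeSemigroup ℬ.∨-commutativeMonoid)
module ∧-CS = CommutativeSemigroupProperties (CommutativeMonoid.commutativeSemigroup ℬ.∧-commutativeMonoid)
module ℚ-CS = CommutativeSemigroupProperties (CommutativeMonoid.commutativeSemigroup ℚ.*-1-commutativeMonoid)

ℚ-ring : AlmostCommutativeRing _ _
ℚ-ring = fromCommutativeRing ℚ.+-*-commutativeRing (λ _ → nothing)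

fromℚᵘ-homo-+ : ∀ p q → fromℚᵘ (p ℚᵘ.+ q) ≡ fromℚᵘ p + fromℚᵘ q
fromℚᵘ-homo-+ p q = ℚ.toℚᵘ-injective (ℚᵘ.≃-trans (ℚ.toℚᵘ-fromℚᵘ _) (ℚᵘ.≃-sym
  (ℚᵘ.≃-trans (ℚ.toℚᵘ-homo-+ (fromℚᵘ p) (fromℚᵘ q))
              (ℚᵘ.+-cong (ℚ.toℚᵘ-fromℚᵘ p) (ℚ.toℚᵘ-fromℚᵘ q)))))

fromℚᵘ-homo-* : ∀ p q → fromℚᵘ (p ℚᵘ.* q) ≡ fromℚᵘ p * fromℚᵘ q
fromℚᵘ-homo-* p q = ℚ.toℚᵘ-injective (ℚᵘ.≃-trans (ℚ.toℚᵘ-fromℚᵘ _) (ℚᵘ.≃-sym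
  (ℚᵘ.≃-trans (ℚ.toℚᵘ-homo-* (fromℚᵘ p) (fromℚᵘ q))
              (ℚᵘ.*-cong (ℚ.toℚᵘ-fromℚᵘ p) (ℚ.toℚᵘ-fromℚᵘ q)))))

toℚ : ℕ → ℚ
toℚ a = a // 1

toℚ-homo-+ : ∀ a b → toℚ (a ℕ.+ b) ≡ toℚ a + toℚ b
toℚ-homo-+ a b = trans (cong (λ i → fromℚᵘ (ℚᵘ.mkℚᵘ i 0)) numerator)
  (fromℚᵘ-homo-+ (ℚᵘ.mkℚᵘ (ℤ.+ a) 0) (ℚᵘ.mkℚᵘ (ℤ.+ b) 0))
  where
  numerator : ℤ.+ (a ℕ.+ b) ≡ ℤ.+ a ℤ.* ℤ.+ 1 ℤ.+ ℤ.+ b ℤ.* ℤ.+ 1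
  numerator = trans (ℤ.pos-+ a b) (sym (cong₂ ℤ._+_ (ℤ.*-identityʳ (ℤ.+ a)) (ℤ.*-identityʳ (ℤ.+ b))))

//-homo-* : ∀ a b c d .{{_ : NonZero b}} .{{_ : NonZero d}} → (a // b) * (c // d) ≡ (a ℕ.* c) // (b ℕ.* d)
//-homo-* a (suc b) c (suc d) = trans (sym (fromℚᵘ-homo-* (ℚᵘ.mkℚᵘ (ℤ.+ a) b) (ℚᵘ.mkℚᵘ (ℤ.+ c) d)))
  (cong (λ i → fromℚᵘ (ℚᵘ.mkℚᵘ i _)) (sym (ℤ.pos-* a c)))

//-cong-cross : ∀ a b c d .{{_ : NonZero b}} .{{_ : NonZero d}} → a ℕ.* d ≡ c ℕ.* b → a // b ≡ c // d
//-cong-cross a (suc b) c (suc d) ad≡cb = ℚ.fromℚᵘ-cong {ℚᵘ.mkℚᵘ (ℤ.+ a) b} {ℚᵘ.mkℚᵘ (ℤ.+ c) d}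
  (ℚᵘ.*≡* (trans (sym (ℤ.pos-* a (suc d))) (trans (cong ℤ.+_ ad≡cb) (ℤ.pos-* c (suc b)))))

toℚ*[1/d]≡a/d : ∀ a d .{{_ : NonZero d}} → toℚ a * (1 // d) ≡ a // d
toℚ*[1/d]≡a/d a d = trans (//-homo-* a 1 1 d) (cong₂ _//_ (ℕ.*-identityʳ a) (ℕ.*-identityˡ d))

neg1^-+ : ∀ a b → neg1^ (a ℕ.+ b) ≡ neg1^ a * neg1^ b
neg1^-+ zero b = sym (ℚ.*-identityˡ (neg1^ b))
neg1^-+ (suc a) b = trans (cong -_ (neg1^-+ a b)) (ℚ.neg-distribˡ-* (neg1^ a) (neg1^ b))

P′-suc : ∀ a j → a P′ suc j ≡ a ℕ.* (ℕ.pred a P′ j)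
P′-suc zero j = cong (ℕ._* (0 P′ j)) (ℕ.0∸n≡0 j)
P′-suc (suc a) j = nP′k≡n[n∸1P′k∸1] (suc a) (suc j)

[m∸s]P′[1+j] : ∀ m s j → (m ∸ s) P′ suc j ≡ (m ∸ s) ℕ.* ((m ∸ suc s) P′ j)
[m∸s]P′[1+j] m s j =
  trans (P′-suc (m ∸ s) j) (cong (λ a → (m ∸ s) ℕ.* (a P′ j)) (ℕ.pred[m∸n]≡m∸[1+n] m s))

P′*[n∸k]!≡n! : ∀ {n k} → k ≤ n → (n P′ k) ℕ.* (n ∸ k) ! ≡ n !
P′*[n∸k]!≡n! {n} {k} k≤n =
  trans (cong (ℕ._* (n ∸ k) !) (nP′k≡n!/[n∸k]! k≤n)) (m/n*n≡m (m≤n⇒m!∣n! (ℕ.m∸n≤m n k)))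
  where instance _ = (n ∸ k) ℕ.!≢0

P′-nonZero : ∀ {n k} → k ≤ n → NonZero (n P′ k)
P′-nonZero {n} {k} k≤n = ℕ.m*n≢0⇒m≢0 (n P′ k) {{subst NonZero (sym (P′*[n∸k]!≡n! k≤n)) (n ℕ.!≢0)}}

^-nonZero : ∀ {n m} → m ≤ n → NonZero (n ^ m)
^-nonZero {zero} ℕ.z≤n = _
^-nonZero {suc n} {m} _ = ℕ.m^n≢0 (suc n) m

Uz≡^/P′ : ∀ {n b} → b ≤ n → Uz n b ≡ (n ^ b) // (n P′ b)
Uz≡^/P′ {n} {b} b≤n with b ℕ.≤ᵇ n | ℕ.≤⇒≤ᵇ b≤n
... | true | _ = refl

[n∸b]!/n^[n∸b]≡n!/n^n*Uz : ∀ {n b} → b ≤ n → ((n ∸ b) !) // (n ^ (n ∸ b)) ≡ ((n !) // (n ^ n)) * Uz n b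
[n∸b]!/n^[n∸b]≡n!/n^n*Uz {n} {b} b≤n = begin
  ((n ∸ b) !) // (n ^ (n ∸ b))
    ≡⟨ //-cong-cross _ _ _ _ cross ⟩
  (n ! ℕ.* n ^ b) // (n ^ n ℕ.* (n P′ b))
    ≡⟨ //-homo-* (n !) (n ^ n) (n ^ b) (n P′ b) ⟨
  ((n !) // (n ^ n)) * ((n ^ b) // (n P′ b))
    ≡⟨ cong (((n !) // (n ^ n)) *_) (Uz≡^/P′ b≤n) ⟨
  ((n !) // (n ^ n)) * Uz n b ∎
  where
  instance
    _ = ^-nonZero {n} {n ∸ b} (ℕ.m∸n≤m n b)
    _ = ^-nonZero {n} {n} ℕ.≤-refl
    _ = P′-nonZero b≤n
    _ = ℕ.m*n≢0 (n ^ n) (n P′ b)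
  n^n≡n^b*n^[n∸b] : n ^ n ≡ n ^ b ℕ.* n ^ (n ∸ b)
  n^n≡n^b*n^[n∸b] = trans (cong (n ^_) (sym (ℕ.m+[n∸m]≡n b≤n))) (ℕ.^-distribˡ-+-* n b (n ∸ b))
  cross : (n ∸ b) ! ℕ.* (n ^ n ℕ.* (n P′ b)) ≡ (n ! ℕ.* n ^ b) ℕ.* n ^ (n ∸ b)
  cross = begin
    (n ∸ b) ! ℕ.* (n ^ n ℕ.* (n P′ b))
      ≡⟨ cong (λ m → (n ∸ b) ! ℕ.* (m ℕ.* (n P′ b))) n^n≡n^b*n^[n∸b] ⟩
    (n ∸ b) ! ℕ.* (n ^ b ℕ.* n ^ (n ∸ b) ℕ.* (n P′ b))
      ≡⟨ rearrange ((n ∸ b) !) (n ^ b) (n ^ (n ∸ b)) (n P′ b) ⟩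
    ((n P′ b) ℕ.* (n ∸ b) ! ℕ.* n ^ b) ℕ.* n ^ (n ∸ b)
      ≡⟨ cong (λ m → m ℕ.* n ^ b ℕ.* n ^ (n ∸ b)) (P′*[n∸k]!≡n! b≤n) ⟩
    (n ! ℕ.* n ^ b) ℕ.* n ^ (n ∸ b) ∎
    where
    rearrange : ∀ f a d p → f ℕ.* (a ℕ.* d ℕ.* p) ≡ p ℕ.* f ℕ.* a ℕ.* d
    rearrange = ℕ-solve-∀

𝟙 : Bool → ℕ
𝟙 true = 1
𝟙 false = 0

count : ∀ {A : Set} → (A → Bool) → List A → ℕ
count p [] = 0
count p (y ∷ ys) = 𝟙 (p y) ℕ.+ count p ys

module _ {A : Set} where

  count-cong : ∀ {p q : A → Bool} → (∀ y → p y ≡ q y) → ∀ l → count p l ≡ count q l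
  count-cong p≗q [] = refl
  count-cong p≗q (y ∷ l) = cong₂ ℕ._+_ (cong 𝟙 (p≗q y)) (count-cong p≗q l)

  count-false : ∀ (l : List A) → count (λ _ → false) l ≡ 0
  count-false [] = refl
  count-false (y ∷ l) = count-false l

  count-∧ˡ : ∀ b (p : A → Bool) l → count (λ y → b ∧ p y) l ≡ (if b then count p l else 0)
  count-∧ˡ true p l = refl
  count-∧ˡ false p l = count-false l

  count-++ : ∀ (p : A → Bool) xs ys → count p (xs ++ ys) ≡ count p xs ℕ.+ count p ys
  count-++ p [] ys = refl
  count-++ p (x ∷ xs) ys = trans (cong (𝟙 (p x) ℕ.+_) (count-++ p xs ys)) (sym (ℕ.+-assoc (𝟙 (p x)) _ _))

  count-tabulate : ∀ {n} (p : A → Bool) (g : Fin n → A) → count p (tabulate g) ≡ sum (λ i → 𝟙 (p (g i)))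
  count-tabulate {zero} p g = refl
  count-tabulate {suc n} p g = cong (𝟙 (p (g zero)) ℕ.+_) (count-tabulate p (g ∘ suc))

  length-filter-T? : ∀ (p : A → Bool) l → length (filter (λ y → T? (p y)) l) ≡ count p l
  length-filter-T? p [] = refl
  length-filter-T? p (y ∷ l) with p y
  ... | false = length-filter-T? p l
  ... | true = cong suc (length-filter-T? p l)

count-concatMap-map : ∀ {A B C : Set} {n} (p : C → Bool) (h : B → A → C) (g : Fin n → B) (l : List A) →
  count p (concatMap (λ t → map (h t) l) (tabulate g)) ≡ sum (λ i → count (λ y → p (h (g i) y)) l)
count-concatMap-map {n = zero} p h g l = refl
count-concatMap-map {n = suc n} p h g l = begin
  count p (map (h (g zero)) l ++ concatMap (λ t → map (h t) l) (tabulate (g ∘ suc)))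
    ≡⟨ count-++ p (map (h (g zero)) l) _ ⟩
  count p (map (h (g zero)) l) ℕ.+ count p (concatMap (λ t → map (h t) l) (tabulate (g ∘ suc)))
    ≡⟨ cong₂ ℕ._+_ (count-map l) (count-concatMap-map p h (g ∘ suc) l) ⟩
  count (λ y → p (h (g zero) y)) l ℕ.+ sum (λ i → count (λ y → p (h (g (suc i)) y)) l) ∎
  where
  count-map : ∀ l → count p (map (h (g zero)) l) ≡ count (λ y → p (h (g zero) y)) l
  count-map [] = refl
  count-map (y ∷ l) = cong (𝟙 (p (h (g zero) y)) ℕ.+_) (count-map l)

sum-const : ∀ n c → sum {n} (λ _ → c) ≡ n ℕ.* c
sum-const zero c = refl
sum-const (suc n) c = cong (c ℕ.+_) (sum-const n c)

sum-if-eqᵇ : ∀ {n} (s : Fin n) (v : Fin n → ℕ) → sum (λ t → if eqᵇ s t then v t else 0) ≡ v s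
sum-if-eqᵇ {suc n} zero v = trans (cong (v zero ℕ.+_) (sum-replicate-zero n)) (ℕ.+-identityʳ (v zero))
sum-if-eqᵇ {suc n} (suc s) v = sum-if-eqᵇ s (v ∘ suc)

if-then-0≡𝟙* : ∀ b m → (if b then m else 0) ≡ 𝟙 b ℕ.* m
if-then-0≡𝟙* true m = sym (ℕ.+-identityʳ m)
if-then-0≡𝟙* false m = refl

sum-if : ∀ {n} b (g : Fin n → ℕ) → sum (λ t → if b then g t else 0) ≡ (if b then sum g else 0)
sum-if true g = refl
sum-if {n} false g = sum-replicate-zero n

module _ {n : ℕ} where

  eqᵇ-refl : ∀ (s : Fin n) → eqᵇ s s ≡ true
  eqᵇ-refl s = dec-true (s ≟ s) refl

  eqᵇ-≢ : ∀ {s t : Fin n} → s ≢ t → eqᵇ s t ≡ false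
  eqᵇ-≢ {s} {t} = dec-false (s ≟ t)

  eqᵇ-true⇒≡ : ∀ (s t : Fin n) → eqᵇ s t ≡ true → s ≡ t
  eqᵇ-true⇒≡ s t with s ≟ t
  ... | yes s≡t = λ _ → s≡t
  ... | no _ = λ ()

  eqᵇ-sym : ∀ (s t : Fin n) → eqᵇ s t ≡ eqᵇ t s
  eqᵇ-sym s t with s ≟ t | t ≟ s
  ... | yes _ | yes _ = refl
  ... | yes s≡t | no t≢s = contradiction (sym s≡t) t≢s
  ... | no s≢t | yes t≡s = contradiction (sym t≡s) s≢t
  ... | no _ | no _ = refl

size : ∀ {n} → (Fin n → Bool) → ℕ
size E = sum (λ t → 𝟙 (E t))

∅ : ∀ {n} → Fin n → Bool
∅ _ = false

insert : ∀ {n} → (Fin n → Bool) → Fin n → Fin n → Bool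
insert E s t = E t ∨ eqᵇ s t

size-cong : ∀ {n} {E E′ : Fin n → Bool} → (∀ t → E t ≡ E′ t) → size E ≡ size E′
size-cong E≗E′ = sum-cong-≗ (cong 𝟙 ∘ E≗E′)

size-∅ : ∀ n → size {n} ∅ ≡ 0
size-∅ = sum-replicate-zero

size-not+size : ∀ {n} (E : Fin n → Bool) → size (not ∘ E) ℕ.+ size E ≡ n
size-not+size {zero} E = refl
size-not+size {suc n} E with E zero
... | true = trans (ℕ.+-suc _ _) (cong suc (size-not+size (E ∘ suc)))
... | false = cong suc (size-not+size (E ∘ suc))

size-not : ∀ {n} (E : Fin n → Bool) → size (not ∘ E) ≡ n ∸ size E
size-not E = trans (sym (ℕ.m+n∸n≡m (size (not ∘ E)) (size E))) (cong (_∸ size E) (size-not+size E))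

size-insert : ∀ {n} (E : Fin n → Bool) (s : Fin n) → E s ≡ false → size (insert E s) ≡ suc (size E)
size-insert {suc n} E zero Es≡false rewrite Es≡false = cong suc (size-cong (ℬ.∨-identityʳ ∘ E ∘ suc))
size-insert {suc n} E (suc s) Es≡false =
  trans (cong₂ ℕ._+_ (cong 𝟙 (ℬ.∨-identityʳ (E zero))) (size-insert (E ∘ suc) s Es≡false))
        (ℕ.+-suc (𝟙 (E zero)) _)

agrees : ∀ {k n} → Subset k → (Fin k → Fin n) → (Fin k → Fin n) → Bool
agrees [] x y = true
agrees (b ∷ B) x y = (if b then eqᵇ (x zero) (y zero) else true) ∧ agrees B (x ∘ suc) (y ∘ suc)

injAvoiding : ∀ {k n} → Subset k → (Fin k → Fin n) → (Fin n → Bool) → Bool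
injAvoiding [] x E = true
injAvoiding (true ∷ B) x E = not (E (x zero)) ∧ injAvoiding B (x ∘ suc) (insert E (x zero))
injAvoiding (false ∷ B) x E = injAvoiding B (x ∘ suc) E

image : ∀ {k n} → Subset k → (Fin k → Fin n) → Fin n → Bool
image [] x t = false
image (b ∷ B) x t = (b ∧ eqᵇ (x zero) t) ∨ image B (x ∘ suc) t

injAvoiding-cong : ∀ {k n} (B : Subset k) (x : Fin k → Fin n) {E E′ : Fin n → Bool} →
  (∀ t → E t ≡ E′ t) → injAvoiding B x E ≡ injAvoiding B x E′
injAvoiding-cong [] x E≗E′ = refl
injAvoiding-cong (true ∷ B) x E≗E′ = cong₂ _∧_ (cong not (E≗E′ (x zero)))
  (injAvoiding-cong B (x ∘ suc) (λ t → cong (_∨ eqᵇ (x zero) t) (E≗E′ t)))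
injAvoiding-cong (false ∷ B) x E≗E′ = injAvoiding-cong B (x ∘ suc) E≗E′

injAvoiding-insert : ∀ {k n} (B : Subset k) (x : Fin k → Fin n) (E : Fin n → Bool) (t : Fin n) →
  injAvoiding B x (insert E t) ≡ injAvoiding B x E ∧ not (image B x t)
injAvoiding-insert [] x E t = refl
injAvoiding-insert (false ∷ B) x E t = injAvoiding-insert B (x ∘ suc) E t
injAvoiding-insert (true ∷ B) x E t = begin
  not (E x₀ ∨ eqᵇ t x₀) ∧ injAvoiding B (x ∘ suc) (insert (insert E t) x₀)
    ≡⟨ cong₂ (λ q J → not (E x₀ ∨ q) ∧ J) (eqᵇ-sym t x₀)
         (injAvoiding-cong B (x ∘ suc) (λ s → ∨-CS.xy∙z≈xz∙y (E s) (eqᵇ t s) (eqᵇ x₀ s))) ⟩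
  not (E x₀ ∨ eqᵇ x₀ t) ∧ injAvoiding B (x ∘ suc) (insert (insert E x₀) t)
    ≡⟨ cong (not (E x₀ ∨ eqᵇ x₀ t) ∧_) (injAvoiding-insert B (x ∘ suc) (insert E x₀) t) ⟩
  not (E x₀ ∨ eqᵇ x₀ t) ∧ (injAvoiding B (x ∘ suc) (insert E x₀) ∧ not (image B (x ∘ suc) t))
    ≡⟨ shuffle (E x₀) (eqᵇ x₀ t) _ _ ⟩
  (not (E x₀) ∧ injAvoiding B (x ∘ suc) (insert E x₀)) ∧ not (eqᵇ x₀ t ∨ image B (x ∘ suc) t) ∎
  where
  x₀ = x zero
  shuffle : ∀ e q J I → not (e ∨ q) ∧ (J ∧ not I) ≡ (not e ∧ J) ∧ not (q ∨ I)
  shuffle true q J I = refl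
  shuffle false true J I = sym (ℬ.∧-zeroʳ J)
  shuffle false false J I = refl

size-∪-image : ∀ {k n} (B : Subset k) (x : Fin k → Fin n) (E : Fin n → Bool) →
  T (injAvoiding B x E) → size (λ t → E t ∨ image B x t) ≡ size E ℕ.+ ∣ B ∣
size-∪-image [] x E _ = trans (size-cong (ℬ.∨-identityʳ ∘ E)) (sym (ℕ.+-identityʳ _))
size-∪-image (true ∷ B) x E inj = begin
  size (λ t → E t ∨ (eqᵇ (x zero) t ∨ image B (x ∘ suc) t))
    ≡⟨ size-cong (λ t → sym (ℬ.∨-assoc (E t) _ _)) ⟩
  size (λ t → insert E (x zero) t ∨ image B (x ∘ suc) t)
    ≡⟨ size-∪-image B (x ∘ suc) (insert E (x zero)) (proj₂ (Equivalence.to ℬ.T-∧ inj)) ⟩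
  size (insert E (x zero)) ℕ.+ ∣ B ∣
    ≡⟨ cong (ℕ._+ ∣ B ∣) (size-insert E (x zero) x₀∉E) ⟩
  suc (size E) ℕ.+ ∣ B ∣
    ≡⟨ ℕ.+-suc (size E) ∣ B ∣ ⟨
  size E ℕ.+ suc ∣ B ∣ ∎
  where
  x₀∉E : E (x zero) ≡ false
  x₀∉E = Equivalence.to ℬ.T-not-≡ (proj₁ (Equivalence.to ℬ.T-∧ inj))
size-∪-image (false ∷ B) x E inj = size-∪-image B (x ∘ suc) E inj

size-fresh : ∀ {k n} (B : Subset k) (x : Fin k → Fin n) (E : Fin n → Bool) →
  T (injAvoiding B x E) → size (λ t → not (E t ∨ image B x t)) ≡ n ∸ (size E ℕ.+ ∣ B ∣)
size-fresh {n = n} B x E inj = trans (size-not (λ t → E t ∨ image B x t)) (cong (n ∸_) (size-∪-image B x E inj))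

injAvoiding-⊤-sound : ∀ {k n} (y : Fin k → Fin n) (E : Fin n → Bool) →
  T (injAvoiding ⊤ y E) → Injective _≡_ _≡_ y × (∀ i → E (y i) ≡ false)
injAvoiding-⊤-sound {zero} y E _ = (λ {i} _ → contradiction i Fin.¬Fin0) , (λ ())
injAvoiding-⊤-sound {suc k} y E h = injective , avoids
  where
  y₀∉E : T (not (E (y zero)))
  y₀∉E = proj₁ (Equivalence.to ℬ.T-∧ h)
  ih = injAvoiding-⊤-sound (y ∘ suc) (insert E (y zero)) (proj₂ (Equivalence.to ℬ.T-∧ h))
  split : ∀ i → E (y (suc i)) ≡ false × eqᵇ (y zero) (y (suc i)) ≡ false
  split i = proj₁ ℬ.∨-conical _ _ (proj₂ ih i) , proj₂ ℬ.∨-conical _ _ (proj₂ ih i)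
  avoids : ∀ i → E (y i) ≡ false
  avoids zero = Equivalence.to ℬ.T-not-≡ y₀∉E
  avoids (suc i) = proj₁ (split i)
  apart : ∀ i → y zero ≢ y (suc i)
  apart i y₀≡yᵢ with trans (sym (eqᵇ-refl (y zero))) (trans (cong (eqᵇ (y zero)) y₀≡yᵢ) (proj₂ (split i)))
  ... | ()
  injective : Injective _≡_ _≡_ y
  injective {zero} {zero} _ = refl
  injective {zero} {suc j} y₀≡yⱼ = contradiction y₀≡yⱼ (apart j)
  injective {suc i} {zero} yᵢ≡y₀ = contradiction (sym yᵢ≡y₀) (apart i)
  injective {suc i} {suc j} yᵢ≡yⱼ = cong suc (proj₁ ih yᵢ≡yⱼ)

injAvoiding-⊤-complete : ∀ {k n} (y : Fin k → Fin n) (E : Fin n → Bool) →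
  Injective _≡_ _≡_ y → (∀ i → E (y i) ≡ false) → T (injAvoiding ⊤ y E)
injAvoiding-⊤-complete {zero} y E _ _ = _
injAvoiding-⊤-complete {suc k} y E inj avoids = Equivalence.from ℬ.T-∧
  ( Equivalence.from ℬ.T-not-≡ (avoids zero)
  , injAvoiding-⊤-complete (y ∘ suc) (insert E (y zero)) (Fin.suc-injective ∘ inj)
      (λ i → cong₂ _∨_ (avoids (suc i)) (eqᵇ-≢ (Fin.0≢1+n ∘ inj))))

injective⇒surjective : ∀ {n} {f : Fin n → Fin n} → Injective _≡_ _≡_ f → ∀ t → ∃ λ i → f i ≡ t
injective⇒surjective {suc n} {f} inj t with Fin.any? (λ i → f i ≟ t)
... | yes hit = hit
... | no miss = contradiction (Fin.injective⇒≤ punchOut∘f-injective) ℕ.1+n≰n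
  where
  t≢f : ∀ i → t ≢ f i
  t≢f i t≡fi = miss (i , sym t≡fi)
  punchOut∘f-injective : Injective _≡_ _≡_ (λ i → punchOut (t≢f i))
  punchOut∘f-injective = inj ∘ Fin.punchOut-injective (t≢f _) (t≢f _)

isBij⇔injective : ∀ {n} (y : Fin n → Fin n) → T (isBij y) ⇔ Injective _≡_ _≡_ y
isBij⇔injective {n} y = mk⇔ to from
  where
  cell : Fin n → Fin n → Bool
  cell i j = if eqᵇ (y i) (y j) then eqᵇ i j else true
  to : T (isBij y) → Injective _≡_ _≡_ y
  to h {i} {j} yᵢ≡yⱼ = eqᵇ-true⇒≡ i j (Equivalence.to ℬ.T-≡ (subst (λ b → T (if b then eqᵇ i j else true))
    (trans (cong (eqᵇ (y i)) (sym yᵢ≡yⱼ)) (eqᵇ-refl (y i))) cellᵢⱼ))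
    where
    rowᵢ = All.tabulate⁻ (all⁺ _ (allFin n) (proj₁ (Equivalence.to ℬ.T-∧ h))) i
    cellᵢⱼ = All.tabulate⁻ (all⁺ (cell i) (allFin n) rowᵢ) j
  cell-ok : Injective _≡_ _≡_ y → ∀ i j → T (cell i j)
  cell-ok inj i j with eqᵇ (y i) (y j) in yᵢ≟yⱼ
  ... | true = Equivalence.from ℬ.T-≡
         (subst (λ j → eqᵇ i j ≡ true) (inj (eqᵇ-true⇒≡ (y i) (y j) yᵢ≟yⱼ)) (eqᵇ-refl i))
  ... | false = _
  from : Injective _≡_ _≡_ y → T (isBij y)
  from inj = Equivalence.from ℬ.T-∧
    ( all⁻ _ (All.tabulate⁺ (λ i → all⁻ (cell i) (All.tabulate⁺ (cell-ok inj i))))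
    , all⁻ _ (All.tabulate⁺ (λ t → let i , yᵢ≡t = injective⇒surjective inj t in
        any⁺ _ (Any.tabulate⁺ i (Equivalence.from ℬ.T-≡ (trans (cong (λ s → eqᵇ s t) yᵢ≡t) (eqᵇ-refl t)))))))

isBij≡injAvoiding : ∀ {n} (y : Fin n → Fin n) → isBij y ≡ injAvoiding ⊤ y ∅
isBij≡injAvoiding y = Reflects.det
  (Reflects.fromEquivalence (Equivalence.to (isBij⇔injective y)) (Equivalence.from (isBij⇔injective y)))
  (Reflects.fromEquivalence (proj₁ ∘ injAvoiding-⊤-sound y ∅)
                            (λ inj → injAvoiding-⊤-complete y ∅ inj (λ _ → refl)))

agreeOn≡agrees : ∀ {n} (B : Subset n) (x y : Fin n → Fin n) → agreeOn B x y ≡ agrees B x y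
agreeOn≡agrees {n} B x y = trans (cong and (List.map-tabulate {n = n} id _)) (and-tabulate B x y)
  where
  and-tabulate : ∀ {k} (B : Subset k) (x y : Fin k → Fin n) →
    and (tabulate (λ i → if lookup B i then eqᵇ (x i) (y i) else true)) ≡ agrees B x y
  and-tabulate [] x y = refl
  and-tabulate (b ∷ B) x y = cong (_ ∧_) (and-tabulate B (x ∘ suc) (y ∘ suc))

count-agrees : ∀ {k n} (B : Subset k) (x : Fin k → Fin n) → count (agrees B x) (allFns n k) ≡ n ^ (k ∸ ∣ B ∣)
count-agrees [] x = refl
count-agrees {suc k} {n} (true ∷ B) x = begin
  count (agrees (true ∷ B) x) (allFns n (suc k))
    ≡⟨ count-concatMap-map {n = n} (agrees (true ∷ B) x) _ id (allFns n k) ⟩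
  sum (λ t → count (λ f → eqᵇ (x zero) t ∧ agrees B (x ∘ suc) f) (allFns n k))
    ≡⟨ sum-cong-≗ (λ t → count-∧ˡ (eqᵇ (x zero) t) _ (allFns n k)) ⟩
  sum (λ t → if eqᵇ (x zero) t then count (agrees B (x ∘ suc)) (allFns n k) else 0)
    ≡⟨ sum-if-eqᵇ (x zero) _ ⟩
  count (agrees B (x ∘ suc)) (allFns n k)
    ≡⟨ count-agrees B (x ∘ suc) ⟩
  n ^ (k ∸ ∣ B ∣) ∎
count-agrees {suc k} {n} (false ∷ B) x = begin
  count (agrees (false ∷ B) x) (allFns n (suc k))
    ≡⟨ count-concatMap-map {n = n} (agrees (false ∷ B) x) _ id (allFns n k) ⟩
  sum {n} (λ _ → count (agrees B (x ∘ suc)) (allFns n k))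
    ≡⟨ sum-const n _ ⟩
  n ℕ.* count (agrees B (x ∘ suc)) (allFns n k)
    ≡⟨ cong (n ℕ.*_) (count-agrees B (x ∘ suc)) ⟩
  n ^ suc (k ∸ ∣ B ∣)
    ≡⟨ cong (n ^_) (ℕ.+-∸-assoc 1 (∣p∣≤n B)) ⟨
  n ^ (suc k ∸ ∣ B ∣) ∎

count-agrees-injective-∷ : ∀ {k n} b (B : Subset k) (x : Fin (suc k) → Fin n) (E : Fin n → Bool) →
  count (λ y → agrees (b ∷ B) x y ∧ injAvoiding ⊤ y E) (allFns n (suc k))
    ≡ sum (λ t → if (if b then eqᵇ (x zero) t else true) ∧ not (E t)
                 then count (λ f → agrees B (x ∘ suc) f ∧ injAvoiding ⊤ f (insert E t)) (allFns n k) else 0)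
count-agrees-injective-∷ {k} {n} b B x E = begin
  count (λ y → agrees (b ∷ B) x y ∧ injAvoiding ⊤ y E) (allFns n (suc k))
    ≡⟨ count-concatMap-map {n = n} (λ y → agrees (b ∷ B) x y ∧ injAvoiding ⊤ y E) _ id (allFns n k) ⟩
  sum (λ t → count (λ f → (agrees₀ t ∧ agrees B (x ∘ suc) f) ∧ (not (E t) ∧ injAvoiding ⊤ f (insert E t)))
                   (allFns n k))
    ≡⟨ sum-cong-≗ (λ t → trans (count-cong (λ f → ∧-CS.interchange (agrees₀ t) _ (not (E t)) _) (allFns n k))
                                (count-∧ˡ (agrees₀ t ∧ not (E t)) _ (allFns n k))) ⟩
  sum (λ t → if agrees₀ t ∧ not (E t)
             then count (λ f → agrees B (x ∘ suc) f ∧ injAvoiding ⊤ f (insert E t)) (allFns n k) else 0) ∎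
  where
  agrees₀ : Fin n → Bool
  agrees₀ t = if b then eqᵇ (x zero) t else true

count-agrees-injective : ∀ {k n} (B : Subset k) (x : Fin k → Fin n) (E : Fin n → Bool) →
  count (λ y → agrees B x y ∧ injAvoiding ⊤ y E) (allFns n k)
    ≡ (if injAvoiding B x E then (n ∸ (size E ℕ.+ ∣ B ∣)) P′ (k ∸ ∣ B ∣) else 0)
count-agrees-injective [] x E = refl
count-agrees-injective {suc k} {n} (true ∷ B) x E = begin
  count (λ y → agrees (true ∷ B) x y ∧ injAvoiding ⊤ y E) (allFns n (suc k))
    ≡⟨ count-agrees-injective-∷ true B x E ⟩
  sum (λ t → if eqᵇ x₀ t ∧ not (E t) then C t else 0)
    ≡⟨ sum-cong-≗ (λ t → ℬ.if-∧ (eqᵇ x₀ t)) ⟩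
  sum (λ t → if eqᵇ x₀ t then (if not (E t) then C t else 0) else 0)
    ≡⟨ sum-if-eqᵇ x₀ (λ t → if not (E t) then C t else 0) ⟩
  (if not (E x₀) then C x₀ else 0)
    ≡⟨ fresh (E x₀) refl ⟩
  (if not (E x₀) ∧ injAvoiding B x′ (insert E x₀) then (n ∸ (size E ℕ.+ suc ∣ B ∣)) P′ (k ∸ ∣ B ∣) else 0) ∎
  where
  x₀ = x zero
  x′ = x ∘ suc
  C : Fin n → ℕ
  C t = count (λ f → agrees B x′ f ∧ injAvoiding ⊤ f (insert E t)) (allFns n k)
  fresh : ∀ b → E x₀ ≡ b → (if not b then C x₀ else 0)
    ≡ (if not b ∧ injAvoiding B x′ (insert E x₀) then (n ∸ (size E ℕ.+ suc ∣ B ∣)) P′ (k ∸ ∣ B ∣) else 0)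
  fresh true _ = refl
  fresh false x₀∉E = trans (count-agrees-injective B x′ (insert E x₀))
    (cong (λ s → if injAvoiding B x′ (insert E x₀) then (n ∸ s) P′ (k ∸ ∣ B ∣) else 0)
      (trans (cong (ℕ._+ ∣ B ∣) (size-insert E x₀ x₀∉E)) (sym (ℕ.+-suc (size E) ∣ B ∣))))
count-agrees-injective {suc k} {n} (false ∷ B) x E = begin
  count (λ y → agrees (false ∷ B) x y ∧ injAvoiding ⊤ y E) (allFns n (suc k))
    ≡⟨ count-agrees-injective-∷ false B x E ⟩
  sum (λ t → if not (E t) then C t else 0)
    ≡⟨ sum-cong-≗ (λ t → choice t (E t) refl) ⟩
  sum (λ t → if J then 𝟙 (not (E t ∨ image B x′ t)) ℕ.* F else 0)
    ≡⟨ sum-if J (λ t → 𝟙 (not (E t ∨ image B x′ t)) ℕ.* F) ⟩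
  (if J then sum (λ t → 𝟙 (not (E t ∨ image B x′ t)) ℕ.* F) else 0)
    ≡⟨ total J refl ⟩
  (if J then (n ∸ (size E ℕ.+ ∣ B ∣)) P′ (suc k ∸ ∣ B ∣) else 0) ∎
  where
  x′ = x ∘ suc
  J = injAvoiding B x′ E
  F = (n ∸ suc (size E ℕ.+ ∣ B ∣)) P′ (k ∸ ∣ B ∣)
  C : Fin n → ℕ
  C t = count (λ f → agrees B x′ f ∧ injAvoiding ⊤ f (insert E t)) (allFns n k)
  choice : ∀ t b → E t ≡ b → (if not b then C t else 0) ≡ (if J then 𝟙 (not (b ∨ image B x′ t)) ℕ.* F else 0)
  choice t true _ = sym (ℬ.if-eta J)
  choice t false t∉E = begin
    C t
      ≡⟨ count-agrees-injective B x′ (insert E t) ⟩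
    (if injAvoiding B x′ (insert E t) then (n ∸ (size (insert E t) ℕ.+ ∣ B ∣)) P′ (k ∸ ∣ B ∣) else 0)
      ≡⟨ cong₂ (λ j s → if j then (n ∸ (s ℕ.+ ∣ B ∣)) P′ (k ∸ ∣ B ∣) else 0)
           (injAvoiding-insert B x′ E t) (size-insert E t t∉E) ⟩
    (if J ∧ not (image B x′ t) then F else 0)
      ≡⟨ trans (ℬ.if-∧ J) (ℬ.if-cong-then J (if-then-0≡𝟙* (not (image B x′ t)) F)) ⟩
    (if J then 𝟙 (not (image B x′ t)) ℕ.* F else 0) ∎
  total : ∀ j → J ≡ j → (if j then sum (λ t → 𝟙 (not (E t ∨ image B x′ t)) ℕ.* F) else 0)
                        ≡ (if j then (n ∸ (size E ℕ.+ ∣ B ∣)) P′ (suc k ∸ ∣ B ∣) else 0)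
  total false _ = refl
  total true J≡true = begin
    sum (λ t → 𝟙 (not (E t ∨ image B x′ t)) ℕ.* F)
      ≡⟨ *-distribʳ-sum F (λ t → 𝟙 (not (E t ∨ image B x′ t))) ⟨
    size (λ t → not (E t ∨ image B x′ t)) ℕ.* F
      ≡⟨ cong (ℕ._* F) (size-fresh B x′ E (Equivalence.from ℬ.T-≡ J≡true)) ⟩
    (n ∸ (size E ℕ.+ ∣ B ∣)) ℕ.* F
      ≡⟨ [m∸s]P′[1+j] n (size E ℕ.+ ∣ B ∣) (k ∸ ∣ B ∣) ⟨
    (n ∸ (size E ℕ.+ ∣ B ∣)) P′ suc (k ∸ ∣ B ∣)
      ≡⟨ cong ((n ∸ (size E ℕ.+ ∣ B ∣)) P′_) (ℕ.+-∸-assoc 1 (∣p∣≤n B)) ⟨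
    (n ∸ (size E ℕ.+ ∣ B ∣)) P′ (suc k ∸ ∣ B ∣) ∎

-- The projections Q_B 1_S

sumℚ-indicator-filter : ∀ {A : Set} (p q : A → Bool) (l : List A) →
  sumℚ (map (λ y → if q y then 1ℚ else 0ℚ) (filter (λ y → T? (p y)) l)) ≡ toℚ (count (λ y → p y ∧ q y) l)
sumℚ-indicator-filter p q [] = refl
sumℚ-indicator-filter p q (y ∷ l) with p y
... | false = sumℚ-indicator-filter p q l
... | true = trans (cong (λ s → (if q y then 1ℚ else 0ℚ) + s) (sumℚ-indicator-filter p q l))
                   (trans (indicator (q y)) (sym (toℚ-homo-+ (𝟙 (q y)) _)))
  where
  indicator : ∀ b → (if b then 1ℚ else 0ℚ) + toℚ (count (λ y → p y ∧ q y) l)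
                    ≡ toℚ (𝟙 b) + toℚ (count (λ y → p y ∧ q y) l)
  indicator true = refl
  indicator false = refl

Q-1S : ∀ {n} (B : Subset n) (x : Fin n → Fin n) →
  Q B 1S x ≡ ((n !) // (n ^ n)) * (if injAvoiding B x ∅ then Uz n ∣ B ∣ else 0ℚ)
Q-1S {n} B x = begin
  Q B 1S x
    ≡⟨ cong₂ (λ u v → u * (1 // v)) (sumℚ-indicator-filter (agreeOn B x) isBij L)
         (trans (List.length-map 1S (filter (λ y → T? (agreeOn B x y)) L)) (length-filter-T? (agreeOn B x) L)) ⟩
  toℚ (count (λ y → agreeOn B x y ∧ isBij y) L) * (1 // count (agreeOn B x) L)
    ≡⟨ cong₂ (λ u v → toℚ u * (1 // v)) bijections-agreeing agreeing ⟩
  toℚ (if J then (n ∸ ∣ B ∣) ! else 0) * (1 // (n ^ (n ∸ ∣ B ∣)))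
    ≡⟨ conclude J ⟩
  ((n !) // (n ^ n)) * (if J then Uz n ∣ B ∣ else 0ℚ) ∎
  where
  L = allFns n n
  J = injAvoiding B x ∅
  agreeing : count (agreeOn B x) L ≡ n ^ (n ∸ ∣ B ∣)
  agreeing = trans (count-cong (agreeOn≡agrees B x) L) (count-agrees B x)
  bijections-agreeing : count (λ y → agreeOn B x y ∧ isBij y) L ≡ (if J then (n ∸ ∣ B ∣) ! else 0)
  bijections-agreeing = begin
    count (λ y → agreeOn B x y ∧ isBij y) L
      ≡⟨ count-cong (λ y → cong₂ _∧_ (agreeOn≡agrees B x y) (isBij≡injAvoiding y)) L ⟩
    count (λ y → agrees B x y ∧ injAvoiding ⊤ y ∅) L
      ≡⟨ count-agrees-injective B x ∅ ⟩
    (if J then (n ∸ (size {n} ∅ ℕ.+ ∣ B ∣)) P′ (n ∸ ∣ B ∣) else 0)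
      ≡⟨ cong (λ s → if J then (n ∸ (s ℕ.+ ∣ B ∣)) P′ (n ∸ ∣ B ∣) else 0) (size-∅ n) ⟩
    (if J then (n ∸ ∣ B ∣) P′ (n ∸ ∣ B ∣) else 0)
      ≡⟨ cong (λ m → if J then m else 0) (nP′n≡n! (n ∸ ∣ B ∣)) ⟩
    (if J then (n ∸ ∣ B ∣) ! else 0) ∎
  conclude : ∀ j → toℚ (if j then (n ∸ ∣ B ∣) ! else 0) * (1 // (n ^ (n ∸ ∣ B ∣)))
                   ≡ ((n !) // (n ^ n)) * (if j then Uz n ∣ B ∣ else 0ℚ)
  conclude false = trans (ℚ.*-zeroˡ (1 // (n ^ (n ∸ ∣ B ∣)))) (sym (ℚ.*-zeroʳ ((n !) // (n ^ n))))
  conclude true = trans (toℚ*[1/d]≡a/d _ _) ([n∸b]!/n^[n∸b]≡n!/n^n*Uz (∣p∣≤n B))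
    where instance _ = ^-nonZero {n} {n ∸ ∣ B ∣} (ℕ.m∸n≤m n ∣ B ∣)

-- Alternating sums over subsets

sumℚ-++ : ∀ (xs ys : List ℚ) → sumℚ (xs ++ ys) ≡ sumℚ xs + sumℚ ys
sumℚ-++ [] ys = sym (ℚ.+-identityˡ _)
sumℚ-++ (x ∷ xs) ys = trans (cong (x +_) (sumℚ-++ xs ys)) (sym (ℚ.+-assoc x _ _))

module _ {A : Set} where

  sumℚ-map-cong : ∀ {f g : A → ℚ} → (∀ a → f a ≡ g a) → ∀ l → sumℚ (map f l) ≡ sumℚ (map g l)
  sumℚ-map-cong f≗g l = cong sumℚ (List.map-cong f≗g l)

  sumℚ-map-filter : ∀ {P : A → Set} (P? : ∀ a → Dec (P a)) (g : A → ℚ) l →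
    sumℚ (map g (filter P? l)) ≡ sumℚ (map (λ a → if does (P? a) then g a else 0ℚ) l)
  sumℚ-map-filter P? g [] = refl
  sumℚ-map-filter P? g (a ∷ l) with does (P? a)
  ... | true = cong (g a +_) (sumℚ-map-filter P? g l)
  ... | false = trans (sumℚ-map-filter P? g l) (sym (ℚ.+-identityˡ _))

  sumℚ-map-zero : ∀ (l : List A) → sumℚ (map (λ _ → 0ℚ) l) ≡ 0ℚ
  sumℚ-map-zero [] = refl
  sumℚ-map-zero (a ∷ l) = trans (ℚ.+-identityˡ _) (sumℚ-map-zero l)

  sumℚ-map-neg : ∀ (f : A → ℚ) l → sumℚ (map (λ a → - f a) l) ≡ - sumℚ (map f l)
  sumℚ-map-neg f [] = refl
  sumℚ-map-neg f (a ∷ l) = trans (cong (- f a +_) (sumℚ-map-neg f l)) (sym (ℚ.neg-distrib-+ (f a) _))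

  sumℚ-map-*ˡ : ∀ r (f : A → ℚ) l → sumℚ (map (λ a → r * f a) l) ≡ r * sumℚ (map f l)
  sumℚ-map-*ˡ r f [] = sym (ℚ.*-zeroʳ r)
  sumℚ-map-*ˡ r f (a ∷ l) = trans (cong (r * f a +_) (sumℚ-map-*ˡ r f l)) (sym (ℚ.*-distribˡ-+ r (f a) _))

sumSubsetsOf : ∀ {k} → Subset k → (Subset k → ℚ) → ℚ
sumSubsetsOf {k} A g = sumℚ (map g (filter (_⊆? A) (allSubsets k)))

sumSubsetsOf-suc : ∀ {k} (A : Subset k) b (g : Subset (suc k) → ℚ) →
  sumSubsetsOf (b ∷ A) g
    ≡ sumSubsetsOf A (λ B → g (outside ∷ B))
      + sumℚ (map (λ B → if does ((inside ∷ B) ⊆? (b ∷ A)) then g (inside ∷ B) else 0ℚ) (allSubsets k))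
sumSubsetsOf-suc {k} A b g = begin
  sumℚ (map g (filter (_⊆? (b ∷ A)) (allSubsets (suc k))))
    ≡⟨ sumℚ-map-filter (_⊆? (b ∷ A)) g (allSubsets (suc k)) ⟩
  sumℚ (map h (map (outside ∷_) S ++ map (inside ∷_) S))
    ≡⟨ trans (cong sumℚ (List.map-++ h (map (outside ∷_) S) _)) (sumℚ-++ (map h (map (outside ∷_) S)) _) ⟩
  sumℚ (map h (map (outside ∷_) S)) + sumℚ (map h (map (inside ∷_) S))
    ≡⟨ cong₂ _+_ (cong sumℚ (sym (List.map-∘ S))) (cong sumℚ (sym (List.map-∘ S))) ⟩
  sumℚ (map (h ∘ (outside ∷_)) S) + sumℚ (map (h ∘ (inside ∷_)) S)
    ≡⟨ cong (_+ sumℚ (map (h ∘ (inside ∷_)) S)) (sym (sumℚ-map-filter (_⊆? A) (λ B → g (outside ∷ B)) S)) ⟩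
  sumSubsetsOf A (λ B → g (outside ∷ B)) + sumℚ (map (h ∘ (inside ∷_)) S) ∎
  where
  S = allSubsets k
  h : Subset (suc k) → ℚ
  h B = if does (B ⊆? (b ∷ A)) then g B else 0ℚ

sumSubsetsOf-outside : ∀ {k} (A : Subset k) (g : Subset (suc k) → ℚ) →
  sumSubsetsOf (outside ∷ A) g ≡ sumSubsetsOf A (λ B → g (outside ∷ B))
sumSubsetsOf-outside {k} A g = trans (sumSubsetsOf-suc A outside g)
  (trans (cong (sumSubsetsOf A (λ B → g (outside ∷ B)) +_) (sumℚ-map-zero (allSubsets k))) (ℚ.+-identityʳ _))

sumSubsetsOf-inside : ∀ {k} (A : Subset k) (g : Subset (suc k) → ℚ) →
  sumSubsetsOf (inside ∷ A) g ≡ sumSubsetsOf A (λ B → g (outside ∷ B)) + sumSubsetsOf A (λ B → g (inside ∷ B))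
sumSubsetsOf-inside {k} A g = trans (sumSubsetsOf-suc A inside g)
  (cong (sumSubsetsOf A (λ B → g (outside ∷ B)) +_)
        (sym (sumℚ-map-filter (_⊆? A) (λ B → g (inside ∷ B)) (allSubsets k))))

shift : (ℕ → ℚ) → ℕ → ℚ
shift c = c ∘ suc

-- Ψ ws c is the value at ∏_{w ∈ ws} (1 - w z) of the linear functional z^j ↦ c j.
Ψ : List ℕ → (ℕ → ℚ) → ℚ
Ψ [] c = c 0
Ψ (w ∷ ws) c = Ψ ws c + - (toℚ w * Ψ ws (shift c))

Ψ-zero∷ : ∀ ws c → Ψ (0 ∷ ws) c ≡ Ψ ws c
Ψ-zero∷ ws c = trans (cong (λ a → Ψ ws c + - a) (ℚ.*-zeroˡ (Ψ ws (shift c)))) (ℚ.+-identityʳ (Ψ ws c))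

Ψ-filter-nonZero : ∀ ws c → Ψ (filter (λ m → ¬? (m ℕ.≟ 0)) ws) c ≡ Ψ ws c
Ψ-filter-nonZero [] c = refl
Ψ-filter-nonZero (zero ∷ ws) c = trans (Ψ-filter-nonZero ws c) (sym (Ψ-zero∷ ws c))
Ψ-filter-nonZero (suc w ∷ ws) c =
  cong₂ (λ a b → a + - (toℚ (suc w) * b)) (Ψ-filter-nonZero ws c) (Ψ-filter-nonZero ws (shift c))

Ψ-tabulate-cong : ∀ {n} {w w′ : Fin n → ℕ} → (∀ t → w t ≡ w′ t) →
  ∀ c → Ψ (tabulate w) c ≡ Ψ (tabulate w′) c
Ψ-tabulate-cong w≗w′ c = cong (λ ws → Ψ ws c) (List.tabulate-cong w≗w′)

Ψ-tabulate-zero : ∀ {n} (w : Fin n → ℕ) c → (∀ t → w t ≡ 0) → Ψ (tabulate w) c ≡ c 0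
Ψ-tabulate-zero {zero} w c _ = refl
Ψ-tabulate-zero {suc n} w c w≗0 = begin
  Ψ (w zero ∷ tabulate (w ∘ suc)) c  ≡⟨ cong (λ m → Ψ (m ∷ tabulate (w ∘ suc)) c) (w≗0 zero) ⟩
  Ψ (0 ∷ tabulate (w ∘ suc)) c       ≡⟨ Ψ-zero∷ (tabulate (w ∘ suc)) c ⟩
  Ψ (tabulate (w ∘ suc)) c           ≡⟨ Ψ-tabulate-zero (w ∘ suc) c (w≗0 ∘ suc) ⟩
  c 0 ∎

-- (1 - (m + 1) z) F = (1 - m z) F - z F, where F is the product of the other factors.
Ψ-split : ∀ {n} (w w′ w″ : Fin n → ℕ) (s : Fin n) c →
  (∀ t → t ≢ s → w t ≡ w′ t) → (∀ t → t ≢ s → w t ≡ w″ t) → w s ≡ suc (w′ s) → w″ s ≡ 0 →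
  Ψ (tabulate w) c ≡ Ψ (tabulate w′) c + - Ψ (tabulate w″) (shift c)
Ψ-split {suc n} w w′ w″ zero c w≗w′ w≗w″ w₀≡1+w′₀ w″₀≡0 = begin
  R c + - (toℚ (w zero) * R (shift c))
    ≡⟨ cong (λ m → R c + - (toℚ m * R (shift c))) w₀≡1+w′₀ ⟩
  R c + - (toℚ (1 ℕ.+ w′ zero) * R (shift c))
    ≡⟨ cong (λ a → R c + - (a * R (shift c))) (toℚ-homo-+ 1 (w′ zero)) ⟩
  R c + - ((1ℚ + toℚ (w′ zero)) * R (shift c))
    ≡⟨ peel (R c) (toℚ (w′ zero)) (R (shift c)) ⟩
  (R c + - (toℚ (w′ zero) * R (shift c))) + - R (shift c)
    ≡⟨ cong₂ (λ a b → (a + - (toℚ (w′ zero) * b)) + - R (shift c)) (R≡R′ c) (R≡R′ (shift c)) ⟩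
  Ψ (tabulate w′) c + - R (shift c)
    ≡⟨ cong (λ a → Ψ (tabulate w′) c + - a) (trans (R≡R″ (shift c)) (sym head″)) ⟩
  Ψ (tabulate w′) c + - Ψ (tabulate w″) (shift c) ∎
  where
  R : (ℕ → ℚ) → ℚ
  R = Ψ (tabulate (w ∘ suc))
  R≡R′ : ∀ c → R c ≡ Ψ (tabulate (w′ ∘ suc)) c
  R≡R′ = Ψ-tabulate-cong (λ t → w≗w′ (suc t) (Fin.0≢1+n ∘ sym))
  R≡R″ : ∀ c → R c ≡ Ψ (tabulate (w″ ∘ suc)) c
  R≡R″ = Ψ-tabulate-cong (λ t → w≗w″ (suc t) (Fin.0≢1+n ∘ sym))
  head″ : Ψ (tabulate w″) (shift c) ≡ Ψ (tabulate (w″ ∘ suc)) (shift c)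
  head″ = trans (cong (λ m → Ψ (m ∷ tabulate (w″ ∘ suc)) (shift c)) w″₀≡0) (Ψ-zero∷ (tabulate (w″ ∘ suc)) (shift c))
  peel : ∀ X a Y → X + - ((1ℚ + a) * Y) ≡ (X + - (a * Y)) + - Y
  peel = solve-∀ ℚ-ring
Ψ-split {suc n} w w′ w″ (suc s) c w≗w′ w≗w″ wₛ≡1+w′ₛ w″ₛ≡0 = begin
  R c + - (toℚ (w zero) * R (shift c))
    ≡⟨ cong₂ (λ a b → a + - (toℚ (w zero) * b)) (ih c) (ih (shift c)) ⟩
  (R′ c + - R″ (shift c)) + - (toℚ (w zero) * (R′ (shift c) + - R″ (shift (shift c))))
    ≡⟨ regroup (toℚ (w zero)) (R′ c) (R′ (shift c)) (R″ (shift c)) (R″ (shift (shift c))) ⟩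
  (R′ c + - (toℚ (w zero) * R′ (shift c))) + - (R″ (shift c) + - (toℚ (w zero) * R″ (shift (shift c))))
    ≡⟨ cong₂ (λ a b → (R′ c + - (toℚ a * R′ (shift c))) + - (R″ (shift c) + - (toℚ b * R″ (shift (shift c)))))
         (w≗w′ zero Fin.0≢1+n) (w≗w″ zero Fin.0≢1+n) ⟩
  Ψ (tabulate w′) c + - Ψ (tabulate w″) (shift c) ∎
  where
  R R′ R″ : (ℕ → ℚ) → ℚ
  R = Ψ (tabulate (w ∘ suc))
  R′ = Ψ (tabulate (w′ ∘ suc))
  R″ = Ψ (tabulate (w″ ∘ suc))
  ih : ∀ c → R c ≡ R′ c + - R″ (shift c)
  ih c = Ψ-split (w ∘ suc) (w′ ∘ suc) (w″ ∘ suc) s c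
    (λ t t≢s → w≗w′ (suc t) (t≢s ∘ Fin.suc-injective)) (λ t t≢s → w≗w″ (suc t) (t≢s ∘ Fin.suc-injective))
    wₛ≡1+w′ₛ w″ₛ≡0
  regroup : ∀ a P₁ P₂ R₁ R₂ →
    (P₁ + - R₁) + - (a * (P₂ + - R₂)) ≡ (P₁ + - (a * P₂)) + - (R₁ + - (a * R₂))
  regroup = solve-∀ ℚ-ring

fibre : ∀ {k n} → Subset k → (Fin k → Fin n) → Fin n → ℕ
fibre [] x t = 0
fibre (b ∷ A) x t = 𝟙 (b ∧ eqᵇ (x zero) t) ℕ.+ fibre A (x ∘ suc) t

fibreAvoiding : ∀ {k n} → Subset k → (Fin k → Fin n) → (Fin n → Bool) → Fin n → ℕ
fibreAvoiding A x E t = if E t then 0 else fibre A x t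

alternatingSum : ∀ {k n} → Subset k → (Fin k → Fin n) → (Fin n → Bool) → (ℕ → ℚ) → ℚ
alternatingSum A x E c = sumSubsetsOf A (λ B → neg1^ ∣ A ─ B ∣ * (if injAvoiding B x E then c ∣ B ∣ else 0ℚ))

fibreAvoiding-used : ∀ {k n} (A : Subset k) (x : Fin (suc k) → Fin n) E → E (x zero) ≡ true →
  ∀ t → fibreAvoiding (true ∷ A) x E t ≡ fibreAvoiding A (x ∘ suc) E t
fibreAvoiding-used A x E x₀∈E t with E t in Et
... | true = refl
... | false rewrite eqᵇ-≢ {s = x zero} {t} (λ x₀≡t → contradiction (trans (sym x₀∈E) (trans (cong E x₀≡t) Et)) λ ())
  = refl

Ψ-fibreAvoiding-fresh : ∀ {k n} (A : Subset k) (x : Fin (suc k) → Fin n) E c → E (x zero) ≡ false →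
  Ψ (tabulate (fibreAvoiding (true ∷ A) x E)) c
    ≡ Ψ (tabulate (fibreAvoiding A (x ∘ suc) E)) c
      + - Ψ (tabulate (fibreAvoiding A (x ∘ suc) (insert E (x zero)))) (shift c)
Ψ-fibreAvoiding-fresh A x E c x₀∉E = Ψ-split _ _ _ x₀ c away away-insert at-x₀ at-x₀-insert
  where
  x₀ = x zero
  away : ∀ t → t ≢ x₀ → fibreAvoiding (true ∷ A) x E t ≡ fibreAvoiding A (x ∘ suc) E t
  away t t≢x₀ rewrite eqᵇ-≢ (t≢x₀ ∘ sym) = refl
  away-insert : ∀ t → t ≢ x₀ → fibreAvoiding (true ∷ A) x E t ≡ fibreAvoiding A (x ∘ suc) (insert E x₀) t
  away-insert t t≢x₀ rewrite eqᵇ-≢ (t≢x₀ ∘ sym) | ℬ.∨-identityʳ (E t) = refl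
  at-x₀ : fibreAvoiding (true ∷ A) x E x₀ ≡ suc (fibreAvoiding A (x ∘ suc) E x₀)
  at-x₀ rewrite x₀∉E | eqᵇ-refl x₀ = refl
  at-x₀-insert : fibreAvoiding A (x ∘ suc) (insert E x₀) x₀ ≡ 0
  at-x₀-insert rewrite eqᵇ-refl x₀ | ℬ.∨-zeroʳ (E x₀) = refl

-- Either the first point of A is left out of B, or it joins B and its value joins E.
alternatingSum≡Ψ : ∀ {k n} (A : Subset k) (x : Fin k → Fin n) E c →
  alternatingSum A x E c ≡ neg1^ ∣ A ∣ * Ψ (tabulate (fibreAvoiding A x E)) c
alternatingSum≡Ψ [] x E c = trans (ℚ.+-identityʳ _)
  (cong (1ℚ *_) (sym (Ψ-tabulate-zero (fibreAvoiding [] x E) c (λ t → ℬ.if-eta (E t)))))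
alternatingSum≡Ψ (false ∷ A) x E c =
  trans (sumSubsetsOf-outside A _) (alternatingSum≡Ψ A (x ∘ suc) E c)
alternatingSum≡Ψ {suc k} (true ∷ A) x E c = begin
  alternatingSum (true ∷ A) x E c
    ≡⟨ sumSubsetsOf-inside A _ ⟩
  sumSubsetsOf A (λ B → (- neg1^ ∣ A ─ B ∣) * (if injAvoiding B x′ E then c ∣ B ∣ else 0ℚ)) + S₂ (E x₀)
    ≡⟨ cong (_+ S₂ (E x₀))
         (trans (sumℚ-map-cong (λ B → sym (ℚ.neg-distribˡ-* (neg1^ ∣ A ─ B ∣) _)) L) (sumℚ-map-neg term L)) ⟩
  - alternatingSum A x′ E c + S₂ (E x₀)
    ≡⟨ step (E x₀) refl ⟩
  (- s) * Ψ (tabulate (fibreAvoiding (true ∷ A) x E)) c ∎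
  where
  x₀ = x zero
  x′ = x ∘ suc
  s = neg1^ ∣ A ∣
  L = filter (_⊆? A) (allSubsets k)
  term : Subset k → ℚ
  term B = neg1^ ∣ A ─ B ∣ * (if injAvoiding B x′ E then c ∣ B ∣ else 0ℚ)
  S₂ : Bool → ℚ
  S₂ b = sumSubsetsOf A
    (λ B → neg1^ ∣ A ─ B ∣ * (if not b ∧ injAvoiding B x′ (insert E x₀) then shift c ∣ B ∣ else 0ℚ))
  step : ∀ b → E x₀ ≡ b →
    - alternatingSum A x′ E c + S₂ b ≡ (- s) * Ψ (tabulate (fibreAvoiding (true ∷ A) x E)) c
  step true x₀∈E = begin
    - alternatingSum A x′ E c + S₂ true
      ≡⟨ cong (- alternatingSum A x′ E c +_)
           (trans (sumℚ-map-cong (λ B → ℚ.*-zeroʳ (neg1^ ∣ A ─ B ∣)) L) (sumℚ-map-zero L)) ⟩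
    - alternatingSum A x′ E c + 0ℚ
      ≡⟨ trans (ℚ.+-identityʳ _) (cong -_ (alternatingSum≡Ψ A x′ E c)) ⟩
    - (s * Ψ (tabulate (fibreAvoiding A x′ E)) c)
      ≡⟨ ℚ.neg-distribˡ-* s _ ⟩
    (- s) * Ψ (tabulate (fibreAvoiding A x′ E)) c
      ≡⟨ cong ((- s) *_) (Ψ-tabulate-cong (fibreAvoiding-used A x E x₀∈E) c) ⟨
    (- s) * Ψ (tabulate (fibreAvoiding (true ∷ A) x E)) c ∎
  step false x₀∉E = begin
    - alternatingSum A x′ E c + alternatingSum A x′ (insert E x₀) (shift c)
      ≡⟨ cong₂ (λ a b → - a + b)
           (alternatingSum≡Ψ A x′ E c) (alternatingSum≡Ψ A x′ (insert E x₀) (shift c)) ⟩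
    - (s * Ψ (tabulate (fibreAvoiding A x′ E)) c) + s * Ψ (tabulate (fibreAvoiding A x′ (insert E x₀))) (shift c)
      ≡⟨ factor s _ _ ⟩
    (- s) * (Ψ (tabulate (fibreAvoiding A x′ E)) c + - Ψ (tabulate (fibreAvoiding A x′ (insert E x₀))) (shift c))
      ≡⟨ cong ((- s) *_) (Ψ-fibreAvoiding-fresh A x E c x₀∉E) ⟨
    (- s) * Ψ (tabulate (fibreAvoiding (true ∷ A) x E)) c ∎
    where
    factor : ∀ s P R → - (s * P) + s * R ≡ (- s) * (P + - R)
    factor = solve-∀ ℚ-ring

-- Polynomials and U

functional : (ℕ → ℚ) → Poly → ℚ
functional c [] = 0ℚ
functional c (a ∷ p) = a * c 0 + functional (shift c) p

functional-cong : ∀ {c c′ : ℕ → ℚ} → (∀ j → c j ≡ c′ j) → ∀ p → functional c p ≡ functional c′ p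
functional-cong c≗c′ [] = refl
functional-cong c≗c′ (a ∷ p) = cong₂ (λ u v → a * u + v) (c≗c′ 0) (functional-cong (c≗c′ ∘ suc) p)

functional-addP : ∀ c p q → functional c (addP p q) ≡ functional c p + functional c q
functional-addP c [] q = sym (ℚ.+-identityˡ _)
functional-addP c (a ∷ p) [] = sym (ℚ.+-identityʳ _)
functional-addP c (a ∷ p) (b ∷ q) =
  trans (cong ((a + b) * c 0 +_) (functional-addP (shift c) p q)) (distribute a b (c 0) _ _)
  where
  distribute : ∀ a b u P Q → (a + b) * u + (P + Q) ≡ (a * u + P) + (b * u + Q)
  distribute = solve-∀ ℚ-ring

functional-scaleP : ∀ c r p → functional c (scaleP r p) ≡ r * functional c p
functional-scaleP c r [] = sym (ℚ.*-zeroʳ r)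
functional-scaleP c r (a ∷ p) =
  trans (cong ((r * a) * c 0 +_) (functional-scaleP (shift c) r p)) (factor r a (c 0) _)
  where
  factor : ∀ r a u P → (r * a) * u + r * P ≡ r * (a * u + P)
  factor = solve-∀ ℚ-ring

functional-0∷ : ∀ c p → functional c (0ℚ ∷ p) ≡ functional (shift c) p
functional-0∷ c p = trans (cong (_+ functional (shift c) p) (ℚ.*-zeroˡ (c 0))) (ℚ.+-identityˡ _)

functional-linP-mulP : ∀ c w q → functional c (mulP (linP w) q) ≡ toℚ w * functional (shift c) q + - functional c q
functional-linP-mulP c w q = begin
  functional c (addP (scaleP (- 1ℚ) q) (0ℚ ∷ addP (scaleP (toℚ w) q) (0ℚ ∷ [])))
    ≡⟨ functional-addP c (scaleP (- 1ℚ) q) _ ⟩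
  functional c (scaleP (- 1ℚ) q) + functional c (0ℚ ∷ addP (scaleP (toℚ w) q) (0ℚ ∷ []))
    ≡⟨ cong₂ _+_ (functional-scaleP c (- 1ℚ) q) (functional-0∷ c (addP (scaleP (toℚ w) q) (0ℚ ∷ []))) ⟩
  (- 1ℚ) * functional c q + functional (shift c) (addP (scaleP (toℚ w) q) (0ℚ ∷ []))
    ≡⟨ cong ((- 1ℚ) * functional c q +_) (functional-addP (shift c) (scaleP (toℚ w) q) _) ⟩
  (- 1ℚ) * functional c q + (functional (shift c) (scaleP (toℚ w) q) + functional (shift c) (0ℚ ∷ []))
    ≡⟨ cong₂ (λ u v → (- 1ℚ) * functional c q + (u + v))
         (functional-scaleP (shift c) (toℚ w) q) (functional-0∷ (shift c) []) ⟩
  (- 1ℚ) * functional c q + (toℚ w * functional (shift c) q + 0ℚ)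
    ≡⟨ rearrange (functional c q) (toℚ w) (functional (shift c) q) ⟩
  toℚ w * functional (shift c) q + - functional c q ∎
  where
  rearrange : ∀ X a Y → (- 1ℚ) * X + (a * Y + 0ℚ) ≡ a * Y + - X
  rearrange X a Y = trans (cong₂ _+_ (-1*x≈-x X) (ℚ.+-identityʳ (a * Y))) (ℚ.+-comm (- X) (a * Y))

functional-∏linP : ∀ c ws → functional c (prodP (map linP ws)) ≡ neg1^ (length ws) * Ψ ws c
functional-∏linP c [] = ℚ.+-identityʳ _
functional-∏linP c (w ∷ ws) = begin
  functional c (mulP (linP w) (prodP (map linP ws)))
    ≡⟨ functional-linP-mulP c w (prodP (map linP ws)) ⟩
  toℚ w * functional (shift c) (prodP (map linP ws)) + - functional c (prodP (map linP ws))
    ≡⟨ cong₂ (λ u v → toℚ w * u + - v) (functional-∏linP (shift c) ws) (functional-∏linP c ws) ⟩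
  toℚ w * (neg1^ (length ws) * Ψ ws (shift c)) + - (neg1^ (length ws) * Ψ ws c)
    ≡⟨ factor (toℚ w) (neg1^ (length ws)) (Ψ ws (shift c)) (Ψ ws c) ⟩
  (- neg1^ (length ws)) * (Ψ ws c + - (toℚ w * Ψ ws (shift c))) ∎
  where
  factor : ∀ a s Y X → a * (s * Y) + - (s * X) ≡ (- s) * (X + - (a * Y))
  factor = solve-∀ ℚ-ring

Ucoeffs≡functional : ∀ n k p → Ucoeffs n k p ≡ functional (λ j → Uz n (k ℕ.+ j)) p
Ucoeffs≡functional n k [] = refl
Ucoeffs≡functional n k (a ∷ p) = cong₂ (λ u v → a * u + v)
  (cong (Uz n) (sym (ℕ.+-identityʳ k)))
  (trans (Ucoeffs≡functional n (suc k) p) (functional-cong (λ j → cong (Uz n) (sym (ℕ.+-suc k j))) p))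

U-∏linP : ∀ {A : Set} n (π : List (List A)) →
  U n (prodP (map (λ p → linP (length p)) π)) ≡ neg1^ (length π) * Ψ (map length π) (Uz n)
U-∏linP n π = begin
  U n (prodP (map (λ p → linP (length p)) π))
    ≡⟨ cong (U n ∘ prodP) (List.map-∘ π) ⟩
  U n (prodP (map linP (map length π)))
    ≡⟨ Ucoeffs≡functional n 0 (prodP (map linP (map length π))) ⟩
  functional (Uz n) (prodP (map linP (map length π)))
    ≡⟨ functional-∏linP (Uz n) (map length π) ⟩
  neg1^ (length (map length π)) * Ψ (map length π) (Uz n)
    ≡⟨ cong (λ l → neg1^ l * Ψ (map length π) (Uz n)) (List.length-map length π) ⟩
  neg1^ (length π) * Ψ (map length π) (Uz n) ∎

map-filter : ∀ {A B : Set} (f : A → B) {P : B → Set} (P? : ∀ b → Dec (P b)) (l : List A) →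
  map f (filter (P? ∘ f) l) ≡ filter P? (map f l)
map-filter f P? [] = refl
map-filter f P? (a ∷ l) with does (P? (f a))
... | true = cong (f a ∷_) (map-filter f P? l)
... | false = map-filter f P? l

sum-lookup-fibre : ∀ {k n} (A : Subset k) (x : Fin k → Fin n) t →
  sum (λ a → 𝟙 (lookup A a ∧ eqᵇ (x a) t)) ≡ fibre A x t
sum-lookup-fibre [] x t = refl
sum-lookup-fibre (b ∷ A) x t = cong (𝟙 (b ∧ eqᵇ (x zero) t) ℕ.+_) (sum-lookup-fibre A (x ∘ suc) t)

map-length-ker : ∀ {n} (A : Subset n) (x : Fin n → Fin n) →
  map length (ker x A) ≡ filter (λ m → ¬? (m ℕ.≟ 0)) (tabulate (fibre A x))
map-length-ker {n} A x = begin
  map length (ker x A)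
    ≡⟨ map-filter length (λ m → ¬? (m ℕ.≟ 0)) (map level (allFin n)) ⟩
  filter (λ m → ¬? (m ℕ.≟ 0)) (map length (map level (allFin n)))
    ≡⟨ cong (filter (λ m → ¬? (m ℕ.≟ 0)))
         (trans (cong (map length) (List.map-tabulate id level)) (List.map-tabulate level length)) ⟩
  filter (λ m → ¬? (m ℕ.≟ 0)) (tabulate (length ∘ level))
    ≡⟨ cong (filter (λ m → ¬? (m ℕ.≟ 0))) (List.tabulate-cong level-size) ⟩
  filter (λ m → ¬? (m ℕ.≟ 0)) (tabulate (fibre A x)) ∎
  where
  level : Fin n → List (Fin n)
  level t = filter (λ a → T? (lookup A a ∧ eqᵇ (x a) t)) (allFin n)
  level-size : ∀ t → length (level t) ≡ fibre A x t
  level-size t = begin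
    length (level t)                                  ≡⟨ length-filter-T? (λ a → lookup A a ∧ eqᵇ (x a) t) (allFin n) ⟩
    count (λ a → lookup A a ∧ eqᵇ (x a) t) (allFin n) ≡⟨ count-tabulate (λ a → lookup A a ∧ eqᵇ (x a) t) id ⟩
    sum (λ a → 𝟙 (lookup A a ∧ eqᵇ (x a) t))         ≡⟨ sum-lookup-fibre A x t ⟩
    fibre A x t                                       ∎

sum-fibre : ∀ {k n} (A : Subset k) (x : Fin k → Fin n) → sum (fibre A x) ≡ ∣ A ∣
sum-fibre {n = n} [] x = sum-replicate-zero n
sum-fibre (false ∷ A) x = sum-fibre A (x ∘ suc)
sum-fibre (true ∷ A) x = begin
  sum (λ t → 𝟙 (eqᵇ (x zero) t) ℕ.+ fibre A (x ∘ suc) t)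
    ≡⟨ ∑-distrib-+ (λ t → 𝟙 (eqᵇ (x zero) t)) (fibre A (x ∘ suc)) ⟩
  sum (λ t → 𝟙 (eqᵇ (x zero) t)) ℕ.+ sum (fibre A (x ∘ suc))
    ≡⟨ cong₂ ℕ._+_ (trans (sum-cong-≗ (λ t → 𝟙-if (eqᵇ (x zero) t))) (sum-if-eqᵇ (x zero) (λ _ → 1)))
                   (sum-fibre A (x ∘ suc)) ⟩
  suc ∣ A ∣ ∎
  where
  𝟙-if : ∀ b → 𝟙 b ≡ (if b then 1 else 0)
  𝟙-if true = refl
  𝟙-if false = refl

length-filter-nonZero≤sum : ∀ ws → length (filter (λ m → ¬? (m ℕ.≟ 0)) ws) ≤ ListAction.sum ws
length-filter-nonZero≤sum [] = ℕ.z≤n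
length-filter-nonZero≤sum (zero ∷ ws) = length-filter-nonZero≤sum ws
length-filter-nonZero≤sum (suc w ∷ ws) = ℕ.s≤s (ℕ.≤-trans (length-filter-nonZero≤sum ws) (ℕ.m≤n+m _ w))

length-ker≤ : ∀ {n} (A : Subset n) (x : Fin n → Fin n) → length (ker x A) ≤ ∣ A ∣
length-ker≤ A x = ℕ.≤-trans (ℕ.≤-reflexive lengths)
  (ℕ.≤-trans (length-filter-nonZero≤sum (tabulate (fibre A x)))
             (ℕ.≤-reflexive (trans (sum-tabulate (fibre A x)) (sum-fibre A x))))
  where
  lengths : length (ker x A) ≡ length (filter (λ m → ¬? (m ℕ.≟ 0)) (tabulate (fibre A x)))
  lengths = trans (sym (List.length-map length (ker x A))) (cong length (map-length-ker A x))
  sum-tabulate : ∀ {m} (f : Fin m → ℕ) → ListAction.sum (tabulate f) ≡ sum f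
  sum-tabulate {zero} f = refl
  sum-tabulate {suc m} f = cong (f zero ℕ.+_) (sum-tabulate (f ∘ suc))

P-1S≡alternatingSum : ∀ {n} (A : Subset n) (x : Fin n → Fin n) →
  P A 1S x ≡ ((n !) // (n ^ n)) * alternatingSum A x ∅ (Uz n)
P-1S≡alternatingSum {n} A x = trans
  (sumℚ-map-cong (λ B → trans (cong (neg1^ ∣ A ─ B ∣ *_) (Q-1S B x)) (ℚ-CS.x∙yz≈y∙xz (neg1^ ∣ A ─ B ∣) K _))
                 L)
  (sumℚ-map-*ˡ K (λ B → neg1^ ∣ A ─ B ∣ * (if injAvoiding B x ∅ then Uz n ∣ B ∣ else 0ℚ)) L)
  where
  K = (n !) // (n ^ n)
  L = filter (_⊆? A) (allSubsets n)

neg1^-rank : ∀ {n} (A : Subset n) (x : Fin n → Fin n) →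
  neg1^ ∣ A ∣ ≡ neg1^ (rank A (ker x A)) * neg1^ (length (ker x A))
neg1^-rank A x = trans (cong neg1^ (sym (ℕ.m∸n+n≡m (length-ker≤ A x)))) (neg1^-+ (rank A (ker x A)) _)

Ψ-fibre≡Ψ-ker : ∀ {n} (A : Subset n) (x : Fin n → Fin n) c →
  Ψ (tabulate (fibre A x)) c ≡ Ψ (map length (ker x A)) c
Ψ-fibre≡Ψ-ker A x c =
  trans (sym (Ψ-filter-nonZero (tabulate (fibre A x)) c)) (cong (λ ws → Ψ ws c) (sym (map-length-ker A x)))

lemma4p4 : (n m : ℕ) (A : Subset n) → ∣ A ∣ ≡ m → (x : Fin n → Fin n) →
    P A 1S x ≡
      neg1^ (rank A (ker x A)) * ((n !) // (n ^ n))
        * U n (prodP (map (λ p → linP (length p)) (ker x A)))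
lemma4p4 n _ A _ x = begin
  P A 1S x
    ≡⟨ P-1S≡alternatingSum A x ⟩
  K * alternatingSum A x ∅ (Uz n)
    ≡⟨ cong (K *_) (alternatingSum≡Ψ A x ∅ (Uz n)) ⟩
  K * (neg1^ ∣ A ∣ * Ψ (tabulate (fibre A x)) (Uz n))
    ≡⟨ cong₂ (λ s y → K * (s * y)) (neg1^-rank A x) (Ψ-fibre≡Ψ-ker A x (Uz n)) ⟩
  K * ((neg1^ (rank A π) * neg1^ (length π)) * Ψ (map length π) (Uz n))
    ≡⟨ regroup K (neg1^ (rank A π)) (neg1^ (length π)) (Ψ (map length π) (Uz n)) ⟩
  neg1^ (rank A π) * K * (neg1^ (length π) * Ψ (map length π) (Uz n))
    ≡⟨ cong (neg1^ (rank A π) * K *_) (U-∏linP n π) ⟨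
  neg1^ (rank A π) * K * U n (prodP (map (λ p → linP (length p)) π)) ∎
  where
  K = (n !) // (n ^ n)
  π = ker x A
  regroup : ∀ k r l y → k * ((r * l) * y) ≡ r * k * (l * y)
  regroup = solve-∀ ℚ-ring
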